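{- Let $p$ be a prime, and for integers $0\le k<N$ define $$s(k,N)=\sum_{\substack{j=\lfloor kp/N\rfloor+1\\ j\neq p}}^{\lfloor (k+1)p/N\rfloor}\frac{1}{j}.$$ Assume $p$ is large enough that each of $s(1,10)$, $s(2,10)$, $s(3,10)$ contains at least one term. Then $$-s(1,10)+2\,s(2,10)+3\,s(3,10)\equiv 0 \pmod p.$$
   Context: The congruence is between rational numbers whose denominators are prime to $p$, taken modulo $p$ (i.e. in $\mathbb{Z}_{(p)}$). -}

module Defs where

open import Data.Nat as ℕ using (ℕ; zero; suc; _∸_; NonZero)
open import Data.Nat.DivMod using (_/_)
open import Data.Nat.Coprimality using (Coprime)
open import Data.Integer using (ℤ; +_)
open import Data.Integer.Divisibility using () renaming (_∣_ to _∣ℤ_)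
open import Data.List using (List; map; filter; upTo; foldr)
open import Data.Product using (_×_)
open import Relation.Nullary.Decidable using (¬?)
open import Data.Rational as ℚ using (ℚ; 0ℚ; _+_; _-_)

indices : (p k N : ℕ) → .{{_ : NonZero N}} → List ℕ
indices p k N =
  filter (λ j → ¬? (j ℕ.≟ p))
    (map (λ i → suc ((k ℕ.* p) / N ℕ.+ i))
         (upTo (((suc k) ℕ.* p) / N ∸ (k ℕ.* p) / N)))

-- 1/j as a rational (j = 0 never occurs among the indices)
recip : ℕ → ℚ
recip zero = 0ℚ
recip (suc n) = (+ 1) ℚ./ suc n

s : (p k N : ℕ) → .{{_ : NonZero N}} → ℚ
s p k N = foldr (λ j acc → recip j + acc) 0ℚ (indices p k N)

-- congruence modulo p in Z_(p): x - y ∈ p Z_(p), i.e. writing x - y = a/b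
-- in lowest terms, p does not divide b and p divides a
infix 4 _≡_[modℚ_]
_≡_[modℚ_] : ℚ → ℚ → ℕ → Set
x ≡ y [modℚ p ] = Coprime p (ℚ.denominatorℕ (x - y)) × ((+ p) ∣ℤ ℚ.numerator (x - y))

-- With A k = ⌊kp/10⌋ and H the harmonic numbers, s(k,10) = H(A(k+1)) − H(A k). Since
-- 2 H(2n+b) − H n = 2 (1 + 1/3 + ⋯ + 1/(2(n+b)−1)) for b ∈ {0,1}, and A 2, A 4 are 2 A 1, 2 A 2
-- up to 1, the combination equals twice the sum of 1/j over the odd j in (A 2, A 4] plus the sum
-- of 1/i over A 3 < i ≤ A 4. For p ≡ 1, 3, 7, 9 (mod 10), i ↦ p − 2i maps the second range onto
-- those odd j, and 1/i + 2/(p − 2i) = p/(i(p − 2i)) lies in pℤ₍ₚ₎.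
module Submission where

open import Defs
open import Data.Nat using (ℕ; _≤_)
open import Data.Nat.Primality using (Prime)
open import Data.Integer using (+_)
open import Data.List using (length)
open import Data.Rational using (0ℚ; _+_; _*_; -_; _/_)

open import Data.Empty using (⊥-elim)
open import Data.Fin using (Fin; toℕ)
open import Data.Fin.Patterns using (0F; 1F; 2F; 3F; 4F; 5F; 6F; 7F; 8F; 9F)
open import Data.Integer as ℤ using (ℤ)
import Data.Integer.Divisibility as ℤDiv
import Data.Integer.Properties as ℤP
import Data.Integer.Tactic.RingSolver as ℤ-Solver
open import Data.List using (List; applyUpTo; filter; foldr; map; upTo; _∷_; [])
import Data.List.Properties as ListP
open import Data.List.Relation.Unary.All.Properties using (applyUpTo⁺₁)
open import Data.Nat as ℕ using (zero; suc; _<_; _∸_; NonZero; z≤n; s≤s)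
open import Data.Nat.Coprimality using (Coprime)
import Data.Nat.Coprimality as Coprimality
open import Data.Nat.Divisibility using (_∣_; divides; >⇒∤; ∣1⇒≡1)
open import Data.Nat.DivMod using (_div_; _divMod_; result)
import Data.Nat.DivMod as DivMod
open import Data.Nat.Primality using (euclidsLemma; prime⇒irreducible; prime⇒nonZero; ¬prime[1])
import Data.Nat.Properties as ℕP
import Data.Nat.Tactic.RingSolver as ℕ-Solver
open import Data.Product using (_,_; _×_)
open import Data.Rational as ℚ using (ℚ; mkℚ; _-_; toℚᵘ)
import Data.Rational.Properties as ℚP
open import Data.Rational.Unnormalised as ℚᵘ using (ℚᵘ; mkℚᵘ; *≡*; _≃_)
import Data.Rational.Unnormalised.Properties as ℚᵘP
open import Data.Sum using (inj₁; inj₂)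
open import Function using (_∘_)
open import Level using (0ℓ)
open import Relation.Binary.PropositionalEquality
open import Relation.Nullary using (¬_; Dec; contradiction)
open import Relation.Nullary.Decidable using (¬?; dec⇒maybe; from-yes)
open import Tactic.RingSolver using (solve; solve-∀)
import Tactic.RingSolver.Core.AlmostCommutativeRing as ACR

ℚ-ring : ACR.AlmostCommutativeRing 0ℓ 0ℓ
ℚ-ring = ACR.fromCommutativeRing ℚP.+-*-commutativeRing (λ x → dec⇒maybe (0ℚ ℚ.≟ x))

two : ℚ
two = + 2 / 1

harmonic : ℕ → ℚ
harmonic zero    = 0ℚ
harmonic (suc n) = harmonic n + recip (suc n)

oddHarmonic : ℕ → ℚ
oddHarmonic zero    = 0ℚ
oddHarmonic (suc n) = oddHarmonic n + recip (suc (2 ℕ.* n))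

recipSum : List ℕ → ℚ
recipSum = foldr (λ j acc → recip j + acc) 0ℚ

recipSum-range : ∀ (f : ℕ → ℕ) a m → (∀ i → f i ≡ suc (a ℕ.+ i)) →
                 recipSum (applyUpTo f m) ≡ harmonic (a ℕ.+ m) - harmonic a
recipSum-range f a zero    _  rewrite ℕP.+-identityʳ a = sym (ℚP.+-inverseʳ (harmonic a))
recipSum-range f a (suc m) f≗ = begin
  recip (f 0) + recipSum (applyUpTo (f ∘ suc) m)
    ≡⟨ cong₂ _+_ (cong recip (trans (f≗ 0) (cong suc (ℕP.+-identityʳ a)))) ih ⟩
  recip (suc a) + (harmonic (suc a ℕ.+ m) - harmonic (suc a))
    ≡⟨ telescope (harmonic (suc a ℕ.+ m)) (harmonic a) (recip (suc a)) ⟩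
  harmonic (suc a ℕ.+ m) - harmonic a
    ≡⟨ cong (λ n → harmonic n - harmonic a) (sym (ℕP.+-suc a m)) ⟩
  harmonic (a ℕ.+ suc m) - harmonic a ∎
  where
  open ≡-Reasoning
  ih : recipSum (applyUpTo (f ∘ suc) m) ≡ harmonic (suc a ℕ.+ m) - harmonic (suc a)
  ih = recipSum-range (f ∘ suc) (suc a) m (λ i → trans (f≗ (suc i)) (cong suc (ℕP.+-suc a i)))
  telescope : ∀ x y r → r + (x - (y + r)) ≡ x - y
  telescope = solve-∀ ℚ-ring

s≡harmonic-difference : ∀ p k N .{{_ : NonZero N}} .{{_ : NonZero p}} → suc k < N →
                        s p k N ≡ harmonic (suc k ℕ.* p div N) - harmonic (k ℕ.* p div N)
s≡harmonic-difference p k N k<N = begin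
  recipSum (filter ≢p? (map f (upTo m)))
    ≡⟨ cong (recipSum ∘ filter ≢p?) (ListP.map-upTo f m) ⟩
  recipSum (filter ≢p? (applyUpTo f m))
    ≡⟨ cong recipSum (ListP.filter-all ≢p? (applyUpTo⁺₁ f m f<p)) ⟩
  recipSum (applyUpTo f m)
    ≡⟨ recipSum-range f a m (λ _ → refl) ⟩
  harmonic (a ℕ.+ m) - harmonic a
    ≡⟨ cong (λ n → harmonic n - harmonic a) a+m≡b ⟩
  harmonic b - harmonic a ∎
  where
  open ≡-Reasoning
  a b m : ℕ
  a = k ℕ.* p div N
  b = suc k ℕ.* p div N
  m = b ∸ a
  f : ℕ → ℕ
  f i = suc (a ℕ.+ i)
  ≢p? : ∀ j → Dec (j ≢ p)
  ≢p? j = ¬? (j ℕ.≟ p)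
  a+m≡b : a ℕ.+ m ≡ b
  a+m≡b = ℕP.m+[n∸m]≡n (DivMod./-monoˡ-≤ N (ℕP.m≤n+m (k ℕ.* p) p))
  b<p : b < p
  b<p = DivMod.m<n*o⇒m/o<n (subst (suc k ℕ.* p <_) (ℕP.*-comm N p) (ℕP.*-monoˡ-< p k<N))
  f<p : ∀ {i} → i < m → f i ≢ p
  f<p {i} i<m fi≡p = ℕP.<-irrefl fi≡p
    (ℕP.≤-<-trans (ℕP.+-monoʳ-< a i<m) (subst (_< p) (sym a+m≡b) b<p))

two*recip-double : ∀ n → two * recip (2 ℕ.+ 2 ℕ.* n) ≡ recip (suc n)
two*recip-double n = ℚP.toℚᵘ-injective (begin
  toℚᵘ (two * recip (2 ℕ.+ 2 ℕ.* n))
    ≈⟨ ℚP.toℚᵘ-homo-* two (recip (2 ℕ.+ 2 ℕ.* n)) ⟩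
  toℚᵘ two ℚᵘ.* toℚᵘ (recip (2 ℕ.+ 2 ℕ.* n))
    ≈⟨ ℚᵘP.*-cong (ℚP.toℚᵘ-fromℚᵘ (mkℚᵘ (+ 2) 0)) (ℚP.toℚᵘ-fromℚᵘ (mkℚᵘ (+ 1) (suc (2 ℕ.* n)))) ⟩
  mkℚᵘ (+ 2) 0 ℚᵘ.* mkℚᵘ (+ 1) (suc (2 ℕ.* n))
    ≈⟨ *≡* (cong +_ (solve (n ∷ []) ℕ-Solver.ring)) ⟩
  mkℚᵘ (+ 1) n
    ≈⟨ ℚᵘP.≃-sym (ℚP.toℚᵘ-fromℚᵘ (mkℚᵘ (+ 1) n)) ⟩
  toℚᵘ (recip (suc n)) ∎)
  where open ℚᵘP.≃-Reasoning

double-harmonic : ∀ n → two * harmonic (2 ℕ.* n) - harmonic n ≡ two * oddHarmonic n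
double-harmonic zero    = refl
double-harmonic (suc n) = begin
  two * harmonic (2 ℕ.* suc n) - harmonic (suc n)
    ≡⟨ cong (λ m → two * harmonic m - harmonic (suc n)) (ℕP.*-suc 2 n) ⟩
  two * (harmonic (2 ℕ.* n) + r + recip (2 ℕ.+ 2 ℕ.* n)) - (harmonic n + recip (suc n))
    ≡⟨ regroup (harmonic (2 ℕ.* n)) (harmonic n) r (recip (2 ℕ.+ 2 ℕ.* n)) (recip (suc n)) ⟩
  (two * harmonic (2 ℕ.* n) - harmonic n) + two * r + (two * recip (2 ℕ.+ 2 ℕ.* n) - recip (suc n))
    ≡⟨ cong₂ (λ x y → x + two * r + (y - recip (suc n))) (double-harmonic n) (two*recip-double n) ⟩
  two * oddHarmonic n + two * r + (recip (suc n) - recip (suc n))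
    ≡⟨ cancel (oddHarmonic n) r (recip (suc n)) ⟩
  two * (oddHarmonic n + r) ∎
  where
  open ≡-Reasoning
  r = recip (suc (2 ℕ.* n))
  regroup : ∀ h₂ h₁ x y z → two * (h₂ + x + y) - (h₁ + z) ≡ (two * h₂ - h₁) + two * x + (two * y - z)
  regroup = solve-∀ ℚ-ring
  cancel : ∀ o x z → two * o + two * x + (z - z) ≡ two * (o + x)
  cancel = solve-∀ ℚ-ring

double-harmonic⁺ : ∀ {b} n → b ≤ 1 → two * harmonic (b ℕ.+ 2 ℕ.* n) - harmonic n ≡ two * oddHarmonic (b ℕ.+ n)
double-harmonic⁺ n z≤n       = double-harmonic n
double-harmonic⁺ n (s≤s z≤n) = begin
  two * (harmonic (2 ℕ.* n) + r) - harmonic n   ≡⟨ regroup (harmonic (2 ℕ.* n)) (harmonic n) r ⟩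
  two * harmonic (2 ℕ.* n) - harmonic n + two * r ≡⟨ cong (_+ two * r) (double-harmonic n) ⟩
  two * oddHarmonic n + two * r                   ≡⟨ ℚP.*-distribˡ-+ two (oddHarmonic n) r ⟨
  two * (oddHarmonic n + r) ∎
  where
  open ≡-Reasoning
  r = recip (suc (2 ℕ.* n))
  regroup : ∀ h₂ h₁ x → two * (h₂ + x) - h₁ ≡ two * h₂ - h₁ + two * x
  regroup = solve-∀ ℚ-ring

-- u = p k / d with p ∤ d, i.e. u lies in the maximal ideal pℤ₍ₚ₎ of ℤ₍ₚ₎.
record Multipleᵘ (p : ℕ) (u : ℚᵘ) : Set where
  constructor multipleᵘ
  field
    d     : ℕ
    p∤d   : ¬ p ∣ d
    k     : ℤ
    cross : ℚᵘ.↥ u ℤ.* + d ≡ + p ℤ.* k ℤ.* ℚᵘ.↧ u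

Multiple : ℕ → ℚ → Set
Multiple p x = Multipleᵘ p (toℚᵘ x)

cross-transfer : ∀ (n₁ e₁ n₂ e₂ x y : ℤ) → n₁ ℤ.* e₂ ≡ n₂ ℤ.* e₁ → n₁ ℤ.* x ≡ y ℤ.* e₁ →
                 n₂ ℤ.* x ℤ.* e₁ ≡ y ℤ.* e₂ ℤ.* e₁
cross-transfer n₁ e₁ n₂ e₂ x y n₁e₂≡n₂e₁ n₁x≡ye₁ = begin
  n₂ ℤ.* x ℤ.* e₁   ≡⟨ solve (n₂ ∷ x ∷ e₁ ∷ []) ℤ-Solver.ring ⟩
  n₂ ℤ.* e₁ ℤ.* x   ≡⟨ cong (ℤ._* x) n₁e₂≡n₂e₁ ⟨
  n₁ ℤ.* e₂ ℤ.* x   ≡⟨ solve (n₁ ∷ e₂ ∷ x ∷ []) ℤ-Solver.ring ⟩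
  n₁ ℤ.* x ℤ.* e₂   ≡⟨ cong (ℤ._* e₂) n₁x≡ye₁ ⟩
  y ℤ.* e₁ ℤ.* e₂   ≡⟨ solve (y ∷ e₁ ∷ e₂ ∷ []) ℤ-Solver.ring ⟩
  y ℤ.* e₂ ℤ.* e₁   ∎
  where open ≡-Reasoning

cross-+ : ∀ (q n₁ e₁ x₁ k₁ n₂ e₂ x₂ k₂ : ℤ) → n₁ ℤ.* x₁ ≡ q ℤ.* k₁ ℤ.* e₁ → n₂ ℤ.* x₂ ≡ q ℤ.* k₂ ℤ.* e₂ →
          (n₁ ℤ.* e₂ ℤ.+ n₂ ℤ.* e₁) ℤ.* (x₁ ℤ.* x₂) ≡ q ℤ.* (k₁ ℤ.* x₂ ℤ.+ k₂ ℤ.* x₁) ℤ.* (e₁ ℤ.* e₂)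
cross-+ q n₁ e₁ x₁ k₁ n₂ e₂ x₂ k₂ eq₁ eq₂ = begin
  (n₁ ℤ.* e₂ ℤ.+ n₂ ℤ.* e₁) ℤ.* (x₁ ℤ.* x₂)
    ≡⟨ solve (n₁ ∷ e₁ ∷ x₁ ∷ n₂ ∷ e₂ ∷ x₂ ∷ []) ℤ-Solver.ring ⟩
  n₁ ℤ.* x₁ ℤ.* (e₂ ℤ.* x₂) ℤ.+ n₂ ℤ.* x₂ ℤ.* (e₁ ℤ.* x₁)
    ≡⟨ cong₂ (λ a b → a ℤ.* (e₂ ℤ.* x₂) ℤ.+ b ℤ.* (e₁ ℤ.* x₁)) eq₁ eq₂ ⟩
  q ℤ.* k₁ ℤ.* e₁ ℤ.* (e₂ ℤ.* x₂) ℤ.+ q ℤ.* k₂ ℤ.* e₂ ℤ.* (e₁ ℤ.* x₁)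
    ≡⟨ solve (q ∷ e₁ ∷ x₁ ∷ k₁ ∷ e₂ ∷ x₂ ∷ k₂ ∷ []) ℤ-Solver.ring ⟩
  q ℤ.* (k₁ ℤ.* x₂ ℤ.+ k₂ ℤ.* x₁) ℤ.* (e₁ ℤ.* e₂) ∎
  where open ≡-Reasoning

multipleᵘ-resp-≃ : ∀ {p u v} → u ≃ v → Multipleᵘ p u → Multipleᵘ p v
multipleᵘ-resp-≃ {p} {u} {v} (*≡* uv) (multipleᵘ d p∤d k cross) =
  multipleᵘ d p∤d k (ℤP.*-cancelʳ-≡ _ _ (ℚᵘ.↧ u)
    (cross-transfer (ℚᵘ.↥ u) (ℚᵘ.↧ u) (ℚᵘ.↥ v) (ℚᵘ.↧ v) (+ d) (+ p ℤ.* k) uv cross))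

module _ {p : ℕ} (p-prime : Prime p) where

  ∤-* : ∀ {m n} → ¬ p ∣ m → ¬ p ∣ n → ¬ p ∣ m ℕ.* n
  ∤-* p∤m p∤n p∣mn with euclidsLemma _ _ p-prime p∣mn
  ... | inj₁ p∣m = p∤m p∣m
  ... | inj₂ p∣n = p∤n p∣n

  multipleᵘ-+ : ∀ {u v} → Multipleᵘ p u → Multipleᵘ p v → Multipleᵘ p (u ℚᵘ.+ v)
  multipleᵘ-+ {u@(mkℚᵘ n₁ _)} {v@(mkℚᵘ n₂ _)} (multipleᵘ d₁ p∤d₁ k₁ cross₁) (multipleᵘ d₂ p∤d₂ k₂ cross₂) =
    multipleᵘ (d₁ ℕ.* d₂) (∤-* p∤d₁ p∤d₂) (k₁ ℤ.* + d₂ ℤ.+ k₂ ℤ.* + d₁)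
      (trans (cong (ℚᵘ.↥ (u ℚᵘ.+ v) ℤ.*_) (ℤP.pos-* d₁ d₂))
        (cross-+ (+ p) n₁ (ℚᵘ.↧ u) (+ d₁) k₁ n₂ (ℚᵘ.↧ v) (+ d₂) k₂ cross₁ cross₂))

  multiple-+ : ∀ {x y} → Multiple p x → Multiple p y → Multiple p (x + y)
  multiple-+ {x} {y} mx my = multipleᵘ-resp-≃ (ℚᵘP.≃-sym (ℚP.toℚᵘ-homo-+ x y)) (multipleᵘ-+ mx my)

  p≢1 : p ≢ 1
  p≢1 p≡1 = ¬prime[1] (subst Prime p≡1 p-prime)

  multiple-0 : Multiple p 0ℚ
  multiple-0 = multipleᵘ 1 (p≢1 ∘ ∣1⇒≡1) (+ 0) (sym (cong (ℤ._* ℤ.1ℤ) (ℤP.*-zeroʳ (+ p))))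

  multiple-reciprocalPair : ∀ a b → suc a ℕ.+ 2 ℕ.* suc b ≡ p → Multiple p (two * recip (suc a) + recip (suc b))
  multiple-reciprocalPair a b a+2b≡p =
    multipleᵘ-resp-≃ (ℚᵘP.≃-sym toℚᵘ-pair) (multipleᵘ (suc a ℕ.* suc b) (∤-* (>⇒∤ a<p) (>⇒∤ b<p)) (+ 1) cross)
    where
    u : ℚᵘ
    u = mkℚᵘ (+ 2) 0 ℚᵘ.* mkℚᵘ (+ 1) a ℚᵘ.+ mkℚᵘ (+ 1) b
    toℚᵘ-pair : toℚᵘ (two * recip (suc a) + recip (suc b)) ≃ u
    toℚᵘ-pair = ℚᵘP.≃-trans (ℚP.toℚᵘ-homo-+ (two * recip (suc a)) (recip (suc b)))
      (ℚᵘP.+-cong (ℚᵘP.≃-trans (ℚP.toℚᵘ-homo-* two (recip (suc a)))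
                    (ℚᵘP.*-cong (ℚP.toℚᵘ-fromℚᵘ (mkℚᵘ (+ 2) 0)) (ℚP.toℚᵘ-fromℚᵘ (mkℚᵘ (+ 1) a))))
                  (ℚP.toℚᵘ-fromℚᵘ (mkℚᵘ (+ 1) b)))
    cross : ℚᵘ.↥ u ℤ.* + (suc a ℕ.* suc b) ≡ + p ℤ.* + 1 ℤ.* ℚᵘ.↧ u
    cross = subst (λ q → ℚᵘ.↥ u ℤ.* + (suc a ℕ.* suc b) ≡ + q ℤ.* + 1 ℤ.* ℚᵘ.↧ u) a+2b≡p
              (cong +_ (solve (a ∷ b ∷ []) ℕ-Solver.ring))
    a<p : suc a < p
    a<p = subst (suc a <_) a+2b≡p (ℕP.m<m+n (suc a) ℕ.z<s)
    b<p : suc b < p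
    b<p = subst (suc b <_) a+2b≡p
      (ℕP.<-≤-trans (ℕP.m<n+m (suc b) ℕ.z<s) (ℕP.+-monoʳ-≤ (suc a) (ℕP.m≤m+n (suc b) (suc b ℕ.+ 0))))

  prime∤⇒coprime : ∀ {m} → ¬ p ∣ m → Coprime p m
  prime∤⇒coprime p∤m (i∣p , i∣m) with prime⇒irreducible p-prime i∣p
  ... | inj₁ i≡1 = i≡1
  ... | inj₂ refl = ⊥-elim (p∤m i∣m)

  multiple⇒≡0 : ∀ {x} → Multiple p x → x ≡ 0ℚ [modℚ p ]
  multiple⇒≡0 {x@(mkℚ n e n⊥e)} (multipleᵘ d p∤d k cross) =
    subst (λ y → Coprime p (ℚ.denominatorℕ y) × (+ p ℤDiv.∣ ℚ.numerator y)) (sym (ℚP.+-identityʳ x))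
      (prime∤⇒coprime (λ p∣e → p≢1 (Coprimality.recompute n⊥e (p∣n , p∣e))) , p∣n)
    where
    abs-cross : ℤ.∣ n ∣ ℕ.* d ≡ ℤ.∣ k ∣ ℕ.* suc e ℕ.* p
    abs-cross = begin
      ℤ.∣ n ∣ ℕ.* d                    ≡⟨ ℤP.abs-* n (+ d) ⟨
      ℤ.∣ n ℤ.* + d ∣                  ≡⟨ cong ℤ.∣_∣ cross ⟩
      ℤ.∣ + p ℤ.* k ℤ.* + suc e ∣      ≡⟨ ℤP.abs-* (+ p ℤ.* k) (+ suc e) ⟩
      ℤ.∣ + p ℤ.* k ∣ ℕ.* suc e        ≡⟨ cong (ℕ._* suc e) (ℤP.abs-* (+ p) k) ⟩
      p ℕ.* ℤ.∣ k ∣ ℕ.* suc e          ≡⟨ ℕP.*-assoc p ℤ.∣ k ∣ (suc e) ⟩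
      p ℕ.* (ℤ.∣ k ∣ ℕ.* suc e)        ≡⟨ ℕP.*-comm p (ℤ.∣ k ∣ ℕ.* suc e) ⟩
      ℤ.∣ k ∣ ℕ.* suc e ℕ.* p          ∎
      where open ≡-Reasoning
    p∣n : p ∣ ℤ.∣ n ∣
    p∣n with euclidsLemma _ _ p-prime (divides (ℤ.∣ k ∣ ℕ.* suc e) abs-cross)
    ... | inj₁ p∣n = p∣n
    ... | inj₂ p∣d = ⊥-elim (p∤d p∣d)

  multiple-pairedSums : ∀ w u v → p ≡ suc (2 ℕ.* (u ℕ.+ v ℕ.+ w)) →
    Multiple p (two * (oddHarmonic (u ℕ.+ w) - oddHarmonic u) + (harmonic (v ℕ.+ w) - harmonic v))
  multiple-pairedSums zero u v _ rewrite ℕP.+-identityʳ u | ℕP.+-identityʳ v =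
    subst (Multiple p) (sym (vanish (oddHarmonic u) (harmonic v))) multiple-0
    where
    vanish : ∀ x y → two * (x - x) + (y - y) ≡ 0ℚ
    vanish = solve-∀ ℚ-ring
  -- Split off 2/(2u+1) + 1/(v+w+1): the smallest odd denominator against the largest one.
  multiple-pairedSums (suc w) u v p≡ rewrite ℕP.+-suc u w | ℕP.+-suc v w =
    subst (Multiple p) (sym (regroup (oddHarmonic (suc (u ℕ.+ w))) (oddHarmonic u) (recip (suc (2 ℕ.* u)))
                                     (harmonic (v ℕ.+ w)) (recip (suc (v ℕ.+ w))) (harmonic v)))
      (multiple-+ (multiple-pairedSums w (suc u) v p≡′)
                  (multiple-reciprocalPair (2 ℕ.* u) (v ℕ.+ w) (trans pair-sum (sym p≡))))
    where
    regroup : ∀ a b r c s e → two * (a - b) + (c + s - e) ≡ (two * (a - (b + r)) + (c - e)) + (two * r + s)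
    regroup = solve-∀ ℚ-ring
    p≡′ : p ≡ suc (2 ℕ.* (suc u ℕ.+ v ℕ.+ w))
    p≡′ = trans p≡ (cong (λ m → suc (2 ℕ.* m)) (ℕP.+-suc (u ℕ.+ v) w))
    pair-sum : suc (2 ℕ.* u) ℕ.+ 2 ℕ.* suc (v ℕ.+ w) ≡ suc (2 ℕ.* (u ℕ.+ v ℕ.+ suc w))
    pair-sum = solve (u ∷ v ∷ w ∷ []) ℕ-Solver.ring

combination : (ℕ → ℕ) → ℚ
combination a = (- (harmonic (a 2) - harmonic (a 1))) + ((+ 2 / 1) * (harmonic (a 3) - harmonic (a 2)))
                + ((+ 3 / 1) * (harmonic (a 4) - harmonic (a 3)))

combination-cong : ∀ {a b : ℕ → ℕ} → (∀ k → a k ≡ b k) → combination a ≡ combination b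
combination-cong a≗b rewrite a≗b 1 | a≗b 2 | a≗b 3 | a≗b 4 = refl

combination≡oddHarmonic : ∀ (a : ℕ → ℕ) {b₁ b₂} → b₁ ≤ 1 → b₂ ≤ 1 →
  a 2 ≡ b₁ ℕ.+ 2 ℕ.* a 1 → a 4 ≡ b₂ ℕ.+ 2 ℕ.* a 2 →
  combination a ≡ two * (oddHarmonic (b₂ ℕ.+ a 2) - oddHarmonic (b₁ ℕ.+ a 1)) + (harmonic (a 4) - harmonic (a 3))
combination≡oddHarmonic a {b₁} {b₂} b₁≤1 b₂≤1 a₂≡ a₄≡ = begin
  combination a
    ≡⟨ regroup (harmonic (a 1)) (harmonic (a 2)) (harmonic (a 3)) (harmonic (a 4)) ⟩
  (two * harmonic (a 4) - harmonic (a 2)) - (two * harmonic (a 2) - harmonic (a 1)) + (harmonic (a 4) - harmonic (a 3))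
    ≡⟨ cong₂ (λ x y → x - y + (harmonic (a 4) - harmonic (a 3))) (doubling a₄≡ b₂≤1) (doubling a₂≡ b₁≤1) ⟩
  two * oddHarmonic (b₂ ℕ.+ a 2) - two * oddHarmonic (b₁ ℕ.+ a 1) + (harmonic (a 4) - harmonic (a 3))
    ≡⟨ factor (oddHarmonic (b₂ ℕ.+ a 2)) (oddHarmonic (b₁ ℕ.+ a 1)) (harmonic (a 4) - harmonic (a 3)) ⟩
  two * (oddHarmonic (b₂ ℕ.+ a 2) - oddHarmonic (b₁ ℕ.+ a 1)) + (harmonic (a 4) - harmonic (a 3)) ∎
  where
  open ≡-Reasoning
  doubling : ∀ {m b n} → m ≡ b ℕ.+ 2 ℕ.* n → b ≤ 1 → two * harmonic m - harmonic n ≡ two * oddHarmonic (b ℕ.+ n)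
  doubling refl = double-harmonic⁺ _
  regroup : ∀ h₁ h₂ h₃ h₄ → (- (h₂ - h₁)) + ((+ 2 / 1) * (h₃ - h₂)) + ((+ 3 / 1) * (h₄ - h₃))
                          ≡ (two * h₄ - h₂) - (two * h₂ - h₁) + (h₄ - h₃)
  regroup = solve-∀ ℚ-ring
  factor : ∀ x y z → two * x - two * y + z ≡ two * (x - y) + z
  factor = solve-∀ ℚ-ring

combination-multiple : ∀ {p} → Prime p → ∀ (a : ℕ → ℕ) {b₁ b₂ w} → b₁ ≤ 1 → b₂ ≤ 1 →
  a 2 ≡ b₁ ℕ.+ 2 ℕ.* a 1 → a 4 ≡ b₂ ℕ.+ 2 ℕ.* a 2 →
  b₁ ℕ.+ a 1 ℕ.+ w ≡ b₂ ℕ.+ a 2 → a 3 ℕ.+ w ≡ a 4 →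
  p ≡ suc (2 ℕ.* (b₁ ℕ.+ a 1 ℕ.+ a 3 ℕ.+ w)) → Multiple p (combination a)
combination-multiple {p} p-prime a {b₁} {b₂} {w} b₁≤1 b₂≤1 a₂≡ a₄≡ odd-end even-end p≡ =
  subst (Multiple p) (sym (combination≡oddHarmonic a b₁≤1 b₂≤1 a₂≡ a₄≡))
    (subst₂ (λ m n → Multiple p (two * (oddHarmonic m - oddHarmonic (b₁ ℕ.+ a 1)) + (harmonic n - harmonic (a 3))))
      odd-end even-end (multiple-pairedSums p-prime w (b₁ ℕ.+ a 1) (a 3) p≡))

[k*[r+q*n]]/n≡[k*r]/n+k*q : ∀ k r q n .{{_ : NonZero n}} → k ℕ.* (r ℕ.+ q ℕ.* n) div n ≡ k ℕ.* r div n ℕ.+ k ℕ.* q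
[k*[r+q*n]]/n≡[k*r]/n+k*q k r q n = begin
  k ℕ.* (r ℕ.+ q ℕ.* n) div n        ≡⟨ cong (_div n) (solve (k ∷ r ∷ q ∷ n ∷ []) ℕ-Solver.ring) ⟩
  (k ℕ.* r ℕ.+ k ℕ.* q ℕ.* n) div n  ≡⟨ DivMod.+-distrib-/-∣ʳ (k ℕ.* r) (divides (k ℕ.* q) refl) ⟩
  k ℕ.* r div n ℕ.+ k ℕ.* q ℕ.* n div n ≡⟨ cong (k ℕ.* r div n ℕ.+_) (DivMod.m*n/n≡m (k ℕ.* q) n) ⟩
  k ℕ.* r div n ℕ.+ k ℕ.* q ∎
  where open ≡-Reasoning

nontrivial∣prime⇒≡ : ∀ {p d} → Prime p → suc (suc d) ∣ p → p ≡ suc (suc d)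
nontrivial∣prime⇒≡ p-prime d∣p with prime⇒irreducible p-prime d∣p
... | inj₂ d≡p = sym d≡p

-- The witnesses are b₁ = A 2 − 2 A 1, b₂ = A 4 − 2 A 2 and w = A 4 − A 3 for A k = ⌊kr/10⌋ + kq.
residue-multiple : ∀ (r : Fin 10) q →
  Prime (toℕ r ℕ.+ q ℕ.* 10) → toℕ r ℕ.+ q ℕ.* 10 ≢ 2 → toℕ r ℕ.+ q ℕ.* 10 ≢ 5 →
  Multiple (toℕ r ℕ.+ q ℕ.* 10) (combination (λ k → k ℕ.* toℕ r div 10 ℕ.+ k ℕ.* q))
residue-multiple 0F q p-prime p≢2 _ =
  ⊥-elim (p≢2 (nontrivial∣prime⇒≡ p-prime (divides (q ℕ.* 5) (solve (q ∷ []) ℕ-Solver.ring))))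
residue-multiple 1F q p-prime _ _ =
  combination-multiple p-prime (λ k → k ℕ.* 1 div 10 ℕ.+ k ℕ.* q) {b₁ = 0} {b₂ = 0} {w = q} z≤n z≤n
    (solve (q ∷ []) ℕ-Solver.ring) (solve (q ∷ []) ℕ-Solver.ring) (solve (q ∷ []) ℕ-Solver.ring)
    (solve (q ∷ []) ℕ-Solver.ring) (solve (q ∷ []) ℕ-Solver.ring)
residue-multiple 2F q p-prime p≢2 _ =
  ⊥-elim (p≢2 (nontrivial∣prime⇒≡ p-prime (divides (1 ℕ.+ q ℕ.* 5) (solve (q ∷ []) ℕ-Solver.ring))))
residue-multiple 3F q p-prime _ _ =
  combination-multiple p-prime (λ k → k ℕ.* 3 div 10 ℕ.+ k ℕ.* q) {b₁ = 0} {b₂ = 1} {w = suc q} z≤n ℕP.≤-refl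
    (solve (q ∷ []) ℕ-Solver.ring) (solve (q ∷ []) ℕ-Solver.ring) (solve (q ∷ []) ℕ-Solver.ring)
    (solve (q ∷ []) ℕ-Solver.ring) (solve (q ∷ []) ℕ-Solver.ring)
residue-multiple 4F q p-prime p≢2 _ =
  ⊥-elim (p≢2 (nontrivial∣prime⇒≡ p-prime (divides (2 ℕ.+ q ℕ.* 5) (solve (q ∷ []) ℕ-Solver.ring))))
residue-multiple 5F q p-prime _ p≢5 =
  ⊥-elim (p≢5 (nontrivial∣prime⇒≡ p-prime (divides (1 ℕ.+ q ℕ.* 2) (solve (q ∷ []) ℕ-Solver.ring))))
residue-multiple 6F q p-prime p≢2 _ =
  ⊥-elim (p≢2 (nontrivial∣prime⇒≡ p-prime (divides (3 ℕ.+ q ℕ.* 5) (solve (q ∷ []) ℕ-Solver.ring))))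
residue-multiple 7F q p-prime _ _ =
  combination-multiple p-prime (λ k → k ℕ.* 7 div 10 ℕ.+ k ℕ.* q) {b₁ = 1} {b₂ = 0} {w = q} ℕP.≤-refl z≤n
    (solve (q ∷ []) ℕ-Solver.ring) (solve (q ∷ []) ℕ-Solver.ring) (solve (q ∷ []) ℕ-Solver.ring)
    (solve (q ∷ []) ℕ-Solver.ring) (solve (q ∷ []) ℕ-Solver.ring)
residue-multiple 8F q p-prime p≢2 _ =
  ⊥-elim (p≢2 (nontrivial∣prime⇒≡ p-prime (divides (4 ℕ.+ q ℕ.* 5) (solve (q ∷ []) ℕ-Solver.ring))))
residue-multiple 9F q p-prime _ _ =
  combination-multiple p-prime (λ k → k ℕ.* 9 div 10 ℕ.+ k ℕ.* q) {b₁ = 1} {b₂ = 1} {w = suc q} ℕP.≤-refl ℕP.≤-refl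
    (solve (q ∷ []) ℕ-Solver.ring) (solve (q ∷ []) ℕ-Solver.ring) (solve (q ∷ []) ℕ-Solver.ring)
    (solve (q ∷ []) ℕ-Solver.ring) (solve (q ∷ []) ℕ-Solver.ring)

decile-combination-multiple : ∀ {p} → Prime p → p ≢ 2 → p ≢ 5 →
  Multiple p (combination (λ k → k ℕ.* p div 10))
decile-combination-multiple {p} p-prime p≢2 p≢5 with p divMod 10
... | result q r refl =
  subst (Multiple _) (combination-cong (λ k → sym ([k*[r+q*n]]/n≡[k*r]/n+k*q k (toℕ r) q 10)))
    (residue-multiple r q p-prime p≢2 p≢5)

-- Only p = 2 and p = 5 need excluding (s(1,10) resp. s(2,10) is empty there).
lemma1 : (p : ℕ) → Prime p →
    1 ≤ length (indices p 1 10) →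
    1 ≤ length (indices p 2 10) →
    1 ≤ length (indices p 3 10) →
    (- s p 1 10) + ((+ 2 / 1) * s p 2 10) + ((+ 3 / 1) * s p 3 10) ≡ 0ℚ [modℚ p ]
lemma1 p p-prime s₁≠∅ s₂≠∅ _ =
  multiple⇒≡0 p-prime (subst (Multiple p) (sym lhs≡combination) (decile-combination-multiple p-prime p≢2 p≢5))
  where
  instance
    p≢0 : NonZero p
    p≢0 = prime⇒nonZero p-prime
  lhs≡combination : (- s p 1 10) + ((+ 2 / 1) * s p 2 10) + ((+ 3 / 1) * s p 3 10)
                    ≡ combination (λ k → k ℕ.* p div 10)
  lhs≡combination = cong₂ _+_
    (cong₂ _+_ (cong -_ (s≡harmonic-difference p 1 10 (from-yes (2 ℕ.<? 10))))
               (cong ((+ 2 / 1) *_) (s≡harmonic-difference p 2 10 (from-yes (3 ℕ.<? 10)))))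
    (cong ((+ 3 / 1) *_) (s≡harmonic-difference p 3 10 (from-yes (4 ℕ.<? 10))))
  p≢2 : p ≢ 2
  p≢2 p≡2 = contradiction (subst (λ n → 1 ≤ length (indices n 1 10)) p≡2 s₁≠∅) λ ()
  p≢5 : p ≢ 5
  p≢5 p≡5 = contradiction (subst (λ n → 1 ≤ length (indices n 2 10)) p≡5 s₂≠∅) λ ()
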